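{- For positive integers $m$ and $n$, not both equal to $1$, the pegging number of the Cartesian product $K_m\times K_n$ is \[ P(K_m\times K_n)=\alpha(K_m\times K_n)+1=\min\{m,n\}+1. \]
   Context: $K_m$ is the complete graph on $m$ vertices; the Cartesian product $G\times H$ has vertex set $V(G)\times V(H)$, with $(g,h)$ adjacent to $(g',h')$ iff either $g=g'$ and $hh'\in E(H)$, or $h=h'$ and $gg'\in E(G)$. $\alpha$ is the independence number. A distribution of pegs on a graph $\Gamma$ is a subset $D \subseteq V(\Gamma)$. If $u,v \in D$ are distinct adjacent vertices and $w \notin D$ is a vertex adjacent to $v$, the pegging move (jumping $u$ over $v$ into $w$) replaces $D$ by $(D\setminus\{u,v\})\cup\{w\}$. A vertex $t$ is reachable from $D$ if some finite (possibly empty) sequence of pegging moves starting from $D$ ends in a distribution containing $t$. The pegging number $P(\Gamma)$ is the smallest positive integer $d$ such that every distribution of size $d$ on $\Gamma$ has every vertex reachable. -}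

module Defs where

open import Level using (0ℓ)
open import Data.Nat using (ℕ; zero; suc; _+_; _≤_; _<_)
open import Data.Bool using (Bool; true; false)
open import Data.Fin using (Fin)
open import Data.List using (List; []; _∷_; allFin; cartesianProduct)
open import Data.Product using (_×_; _,_; ∃; ∃-syntax; Σ)
open import Data.Sum using (_⊎_)
open import Relation.Nullary using (¬_)
open import Relation.Binary.PropositionalEquality using (_≡_; _≢_)
open import Relation.Binary.Construct.Closure.ReflexiveTransitive using (Star)
open import Function.Bundles using (_⇔_)

-- A finite simple graph: vertex type, an explicit duplicate-free
-- list of all vertices (used to count sizes of vertex sets), and adjacency.
record Graph : Set₁ where
  field
    V     : Set
    verts : List V
    Adj   : V → V → Set
open Graph public

K : ℕ → Graph
K m = record
  { V = Fin m
  ; verts = allFin m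
  ; Adj = λ x y → x ≢ y
  }

_□_ : Graph → Graph → Graph
G □ H = record
  { V = V G × V H
  ; verts = cartesianProduct (verts G) (verts H)
  ; Adj = λ { (g , h) (g' , h') →
        (g ≡ g' × Adj H h h') ⊎ (h ≡ h' × Adj G g g') }
  }

count : {A : Set} → (A → Bool) → List A → ℕ
count P [] = 0
count P (x ∷ xs) with P x
... | true  = suc (count P xs)
... | false = count P xs

Distribution : Graph → Set
Distribution G = V G → Bool

size : (G : Graph) → Distribution G → ℕ
size G D = count D (verts G)

Move : (G : Graph) → Distribution G → Distribution G → Set
Move G D D' = ∃[ u ] ∃[ v ] ∃[ w ]
  ( D u ≡ true × D v ≡ true × u ≢ v × Adj G u v
  × D w ≡ false × Adj G v w
  × (∀ x → (D' x ≡ true) ⇔ (x ≡ w ⊎ (D x ≡ true × x ≢ u × x ≢ v))) )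

Reachable : (G : Graph) → Distribution G → V G → Set
Reachable G D t = ∃[ D' ] (Star (Move G) D D' × D' t ≡ true)

AllReachable : Graph → ℕ → Set
AllReachable G d = ∀ (D : Distribution G) → size G D ≡ d → ∀ t → Reachable G D t

IsPeggingNumber : Graph → ℕ → Set
IsPeggingNumber G d =
  1 ≤ d × AllReachable G d × (∀ d' → 1 ≤ d' → d' < d → ¬ AllReachable G d')

Independent : (G : Graph) → Distribution G → Set
Independent G S = ∀ x y → S x ≡ true → S y ≡ true → ¬ Adj G x y

IsIndependenceNumber : Graph → ℕ → Set
IsIndependenceNumber G k =
  (∃[ S ] (Independent G S × size G S ≡ k))
  × (∀ S → Independent G S → size G S ≤ k)

-- Rows and columns of K m × K n are cliques, so an independent set has at most
-- one peg per row and per column, and a diagonal of any length e ≤ m ⊓ n is an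
-- independent set of size e; no move at all is possible from it, so any vertex
-- off the diagonal stays unreachable and P > m ⊓ n.
--
-- Conversely take m ⊓ n = m (the other case is the transpose) and m + 1 pegs,
-- with target t = (a , b) empty.  Two pegs in a row r let us fill any cell
-- (r , c) by one jump along the row without touching the other pegs.  If row a
-- holds a peg (a , y), pigeonhole gives a row i with two pegs; for i = a jump
-- straight into t, otherwise fill (i , y) and jump it over (a , y) into t.  If
-- row a is empty, the m + 1 pegs lie in the other m − 1 rows, so some row has
-- three pegs or two rows have two: in the first case fill (r , b) from two of
-- them and jump the third, chosen off column b, over it into t; in the second
-- fill (r₂ , b), then fill (r₁ , b) and jump it over (r₂ , b) into t.
module Submission where

open import Defs
open import Data.Nat using (ℕ; _+_; _≤_; _⊓_)
open import Data.Product using (_×_; ∃-syntax)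
open import Relation.Nullary using (¬_)
open import Relation.Binary.PropositionalEquality using (_≡_)

open import Data.Nat using (zero; suc; _<_; z≤n; s≤s; _≡ᵇ_; _<ᵇ_; _≤?_)
open import Data.Nat.Properties
open import Algebra.Properties.CommutativeMonoid.Sum +-0-commutativeMonoid
  using (sum-syntax; sum-cong-≗; sum-remove; sum-replicate-zero; ∑-comm)
open import Data.Bool using (Bool; true; false; _∧_; T)
open import Data.Bool.Properties using (∧-zeroʳ; T-∧; T-≡)
open import Data.Fin as Fin using (Fin; toℕ; punchIn)
open import Data.Fin.Properties as Finₚ using (any?; punchIn-injective; punchInᵢ≢i)
open import Data.List using (List; []; _∷_; _++_; map; tabulate; allFin; cartesianProduct)
import Data.Product as Product
open Product using (_,_; proj₁; proj₂; swap)
open import Data.Product.Properties using (≡-dec; ,-injectiveˡ; ,-injectiveʳ)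
open import Data.Sum using (_⊎_; inj₁; inj₂)
import Data.Sum as Sum
open import Data.Unit using (tt)
open import Function using (_∘_; Injective; _⇔_; mk⇔; Equivalence)
open import Relation.Nullary using (yes; no; contradiction)
open import Relation.Binary.Definitions using (DecidableEquality)
open import Relation.Binary.PropositionalEquality
  using (refl; sym; trans; cong; cong₂; subst; _≢_; module ≡-Reasoning)
open import Relation.Binary.Construct.Closure.ReflexiveTransitive
  using (Star; ε; _◅_; _◅◅_; gmap)

private
  variable
    k : ℕ

indicator : Bool → ℕ
indicator true  = 1
indicator false = 0

count-∷ : {A : Set} (P : A → Bool) (x : A) (xs : List A) →
          count P (x ∷ xs) ≡ indicator (P x) + count P xs
count-∷ P x xs with P x
... | true  = refl
... | false = refl

count-++ : {A : Set} (P : A → Bool) (xs ys : List A) →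
           count P (xs ++ ys) ≡ count P xs + count P ys
count-++ P []       ys = refl
count-++ P (x ∷ xs) ys = begin
  count P (x ∷ xs ++ ys)                       ≡⟨ count-∷ P x (xs ++ ys) ⟩
  indicator (P x) + count P (xs ++ ys)          ≡⟨ cong (indicator (P x) +_) (count-++ P xs ys) ⟩
  indicator (P x) + (count P xs + count P ys)   ≡⟨ +-assoc (indicator (P x)) _ _ ⟨
  indicator (P x) + count P xs + count P ys     ≡⟨ cong (_+ count P ys) (count-∷ P x xs) ⟨
  count P (x ∷ xs) + count P ys                 ∎
  where open ≡-Reasoning

count-map : {A B : Set} (P : B → Bool) (g : A → B) (xs : List A) →
            count P (map g xs) ≡ count (P ∘ g) xs
count-map P g []       = refl
count-map P g (x ∷ xs) =
  trans (count-∷ P (g x) (map g xs))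
        (trans (cong (indicator (P (g x)) +_) (count-map P g xs))
               (sym (count-∷ (P ∘ g) x xs)))

count-tabulate : {A : Set} (P : A → Bool) (f : Fin k → A) →
                 count P (tabulate f) ≡ ∑[ i < k ] indicator (P (f i))
count-tabulate {zero}  P f = refl
count-tabulate {suc k} P f =
  trans (count-∷ P (f Fin.zero) _) (cong (_ +_) (count-tabulate P (f ∘ Fin.suc)))

count-cartesianProduct :
  {A B : Set} (P : A × B → Bool) (f : Fin k → A) (ys : List B) →
  count P (cartesianProduct (tabulate f) ys) ≡ ∑[ i < k ] count (λ y → P (f i , y)) ys
count-cartesianProduct {zero}  P f ys = refl
count-cartesianProduct {suc k} P f ys =
  trans (count-++ P (map (f Fin.zero ,_) ys) _)
        (cong₂ _+_ (count-map P _ ys) (count-cartesianProduct P (f ∘ Fin.suc) ys))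

pegsInRow : {m n : ℕ} → Distribution (K m □ K n) → Fin m → ℕ
pegsInRow {n = n} D i = ∑[ j < n ] indicator (D (i , j))

size-□ : {m n : ℕ} (D : Distribution (K m □ K n)) →
         size (K m □ K n) D ≡ ∑[ i < m ] pegsInRow D i
size-□ {m} {n} D =
  trans (count-cartesianProduct D (λ i → i) (allFin n))
        (sum-cong-≗ (λ i → count-tabulate (λ j → D (i , j)) (λ j → j)))

∃-true : (P : Fin k → Bool) → 1 ≤ ∑[ i < k ] indicator (P i) → ∃[ i ] P i ≡ true
∃-true {zero} P ()
∃-true {suc k} P h with P Fin.zero in eq
... | true  = Fin.zero , eq
... | false with ∃-true (P ∘ Fin.suc) h
...   | i , pi = Fin.suc i , pi

∃₂-true : (P : Fin k → Bool) → 2 ≤ ∑[ i < k ] indicator (P i) →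
          ∃[ i ] ∃[ i′ ] (i ≢ i′ × P i ≡ true × P i′ ≡ true)
∃₂-true {zero} P ()
∃₂-true {suc k} P h with P Fin.zero in eq
∃₂-true {suc k} P (s≤s h) | true with ∃-true (P ∘ Fin.suc) h
... | i , pi = Fin.zero , Fin.suc i , (λ ()) , eq , pi
∃₂-true {suc k} P h | false with ∃₂-true (P ∘ Fin.suc) h
... | i , i′ , i≢i′ , pi , pi′ =
  Fin.suc i , Fin.suc i′ , i≢i′ ∘ Finₚ.suc-injective , pi , pi′

∃₃-true : (P : Fin k → Bool) → 3 ≤ ∑[ i < k ] indicator (P i) →
          ∃[ i ] ∃[ i′ ] ∃[ i″ ] (i ≢ i′ × i ≢ i″ × i′ ≢ i″ ×
                                 P i ≡ true × P i′ ≡ true × P i″ ≡ true)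
∃₃-true {zero} P ()
∃₃-true {suc k} P h with P Fin.zero in eq
∃₃-true {suc k} P (s≤s h) | true with ∃₂-true (P ∘ Fin.suc) h
... | i , i′ , i≢i′ , pi , pi′ =
  Fin.zero , Fin.suc i , Fin.suc i′ , (λ ()) , (λ ()) ,
  i≢i′ ∘ Finₚ.suc-injective , eq , pi , pi′
∃₃-true {suc k} P h | false with ∃₃-true (P ∘ Fin.suc) h
... | i , i′ , i″ , i≢i′ , i≢i″ , i′≢i″ , pi , pi′ , pi″ =
  Fin.suc i , Fin.suc i′ , Fin.suc i″ ,
  i≢i′ ∘ Finₚ.suc-injective , i≢i″ ∘ Finₚ.suc-injective ,
  i′≢i″ ∘ Finₚ.suc-injective , pi , pi′ , pi″

∑-≤-card : (f : Fin k → ℕ) → (∀ i → f i ≤ 1) → ∑[ i < k ] f i ≤ k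
∑-≤-card {zero}  f h = z≤n
∑-≤-card {suc k} f h = +-mono-≤ (h Fin.zero) (∑-≤-card (f ∘ Fin.suc) (h ∘ Fin.suc))

pigeonhole : (f : Fin k → ℕ) → suc k ≤ ∑[ i < k ] f i → ∃[ i ] 2 ≤ f i
pigeonhole f h with any? (λ i → 2 ≤? f i)
... | yes found = found
... | no none = contradiction h (<⇒≱ (s≤s (∑-≤-card f at-most-one)))
  where
  at-most-one : ∀ i → f i ≤ 1
  at-most-one i = ≤-pred (≰⇒> (none ∘ (i ,_)))

data Crowded {k : ℕ} (f : Fin k → ℕ) : Set where
  triple  : ∀ i → 3 ≤ f i → Crowded f
  doubles : ∀ i i′ → i ≢ i′ → 2 ≤ f i → 2 ≤ f i′ → Crowded f

crowded-∘ : {l : ℕ} {f : Fin k → ℕ} {g : Fin l → Fin k} →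
            Injective _≡_ _≡_ g → Crowded (f ∘ g) → Crowded f
crowded-∘ {g = g} g-inj (triple i h) = triple (g i) h
crowded-∘ {g = g} g-inj (doubles i i′ i≢i′ h h′) =
  doubles (g i) (g i′) (i≢i′ ∘ g-inj) h h′

-- Some cell holds at least two; if it holds exactly two, the other k − 1 cells
-- still hold k.
pigeonhole₂ : (f : Fin k → ℕ) → 2 + k ≤ ∑[ i < k ] f i → Crowded f
pigeonhole₂ {zero}  f ()
pigeonhole₂ {suc k} f h with pigeonhole f (≤-trans (n≤1+n _) h)
... | i , 2≤fi with 3 ≤? f i
...   | yes 3≤fi = triple i 3≤fi
...   | no  3≰fi = second-double (pigeonhole (f ∘ punchIn i) rest-full)
  where
  second-double : ∃[ j ] 2 ≤ f (punchIn i j) → Crowded f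
  second-double (j , 2≤fj) = doubles i (punchIn i j) (punchInᵢ≢i i j ∘ sym) 2≤fi 2≤fj

  rest-full : suc k ≤ ∑[ j < k ] f (punchIn i j)
  rest-full = +-cancelˡ-≤ 2 _ _ (≤-trans (subst (2 + suc k ≤_) (sum-remove f) h)
                                         (+-monoˡ-≤ _ (≤-pred (≰⇒> 3≰fi))))

pigeonhole₂-with-empty : (f : Fin k → ℕ) (a : Fin k) → f a ≡ 0 →
                   suc k ≤ ∑[ i < k ] f i → Crowded f
pigeonhole₂-with-empty {suc k} f a fa≡0 h =
  crowded-∘ (punchIn-injective a _ _)
            (pigeonhole₂ (f ∘ punchIn a) (subst (2 + k ≤_) total≡rest h))
  where
  total≡rest : ∑[ i < suc k ] f i ≡ ∑[ j < k ] f (punchIn a j)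
  total≡rest = trans (sum-remove {i = a} f) (cong (_+ ∑[ j < k ] f (punchIn a j)) fa≡0)

peg≢hole : {A : Set} {D : A → Bool} {x y : A} → D x ≡ true → D y ≡ false → x ≢ y
peg≢hole Dx Dy refl = contradiction (trans (sym Dx) Dy) λ ()

positive≢zero : {A : Set} {f : A → ℕ} {x y : A} → 1 ≤ f x → f y ≡ 0 → x ≢ y
positive≢zero 1≤fx fy≡0 refl = contradiction (subst (1 ≤_) fy≡0 1≤fx) λ ()

reachable-after : {G : Graph} {D D′ : Distribution G} {t : V G} →
                  Star (Move G) D D′ → Reachable G D′ t → Reachable G D t
reachable-after moves (D″ , moves′ , Dt) = D″ , moves ◅◅ moves′ , Dt

module Jumps {G : Graph} (_≟_ : DecidableEquality (V G)) where

  jump : Distribution G → V G → V G → V G → Distribution G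
  jump D u v w x with x ≟ w | x ≟ u | x ≟ v
  ... | yes _ | _     | _     = true
  ... | no _  | yes _ | _     = false
  ... | no _  | no _  | yes _ = false
  ... | no _  | no _  | no _  = D x

  jump-spec : ∀ D u v w x →
              (jump D u v w x ≡ true) ⇔ (x ≡ w ⊎ (D x ≡ true × x ≢ u × x ≢ v))
  jump-spec D u v w x = mk⇔ to from
    where
    to : jump D u v w x ≡ true → x ≡ w ⊎ (D x ≡ true × x ≢ u × x ≢ v)
    to h with x ≟ w | x ≟ u | x ≟ v
    ... | yes x≡w | _      | _      = inj₁ x≡w
    ... | no _    | no x≢u | no x≢v = inj₂ (h , x≢u , x≢v)
    to () | no _ | yes _ | _
    to () | no _ | no _  | yes _
    from : x ≡ w ⊎ (D x ≡ true × x ≢ u × x ≢ v) → jump D u v w x ≡ true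
    from h with x ≟ w | x ≟ u | x ≟ v | h
    ... | yes _ | _       | _       | _                  = refl
    ... | no x≢w | _      | _       | inj₁ x≡w           = contradiction x≡w x≢w
    ... | no _   | yes x≡u | _      | inj₂ (_ , x≢u , _) = contradiction x≡u x≢u
    ... | no _   | no _   | yes x≡v | inj₂ (_ , _ , x≢v) = contradiction x≡v x≢v
    ... | no _   | no _   | no _    | inj₂ (Dx , _)      = Dx

  jump-keeps-holes : ∀ D u v w x → x ≢ w → D x ≡ false → jump D u v w x ≡ false
  jump-keeps-holes D u v w x x≢w Dx with x ≟ w | x ≟ u | x ≟ v
  ... | yes x≡w | _     | _     = contradiction x≡w x≢w
  ... | no _    | yes _ | _     = refl
  ... | no _    | no _  | yes _ = refl
  ... | no _    | no _  | no _  = Dx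

  jump-move : ∀ {D u v w} → D u ≡ true → D v ≡ true → u ≢ v → Adj G u v →
              D w ≡ false → Adj G v w → Move G D (jump D u v w)
  jump-move {D} {u} {v} {w} Du Dv u≢v uv Dw vw =
    u , v , w , Du , Dv , u≢v , uv , Dw , vw , jump-spec D u v w

  reachable-by-jump : ∀ {D u v w} → D u ≡ true → D v ≡ true → u ≢ v → Adj G u v →
                      D w ≡ false → Adj G v w → Reachable G D w
  reachable-by-jump {D} {u} {v} {w} Du Dv u≢v uv Dw vw =
    jump D u v w , jump-move Du Dv u≢v uv Dw vw ◅ ε ,
    Equivalence.from (jump-spec D u v w w) (inj₁ refl)

independent⇒¬reachable : (G : Graph) {S : Distribution G} {t : V G} →
                         Independent G S → S t ≡ false → ¬ Reachable G S t
independent⇒¬reachable G S-ind St (_ , ε , St′) = contradiction (trans (sym St′) St) λ ()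
independent⇒¬reachable G S-ind St (_ , (u , v , _ , Su , Sv , _ , uv , _) ◅ _ , _) =
  S-ind u v Su Sv uv

independent⇒¬AllReachable : (G : Graph) {S : Distribution G} {t : V G} →
                            Independent G S → S t ≡ false → ¬ AllReachable G (size G S)
independent⇒¬AllReachable G S-ind St all =
  independent⇒¬reachable G S-ind St (all _ refl _)

module _ {G H : Graph} where

  adjacent-swap : {x y : V (H □ G)} → Adj (H □ G) x y → Adj (G □ H) (swap x) (swap y)
  adjacent-swap = Sum.swap

  independent-swap : {S : Distribution (G □ H)} →
                     Independent (G □ H) S → Independent (H □ G) (S ∘ swap)
  independent-swap S-ind x y Sx Sy = S-ind (swap x) (swap y) Sx Sy ∘ adjacent-swap

  move-swap : {E E′ : Distribution (H □ G)} →
              Move (H □ G) E E′ → Move (G □ H) (E ∘ swap) (E′ ∘ swap)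
  move-swap {E} {E′} (u , v , w , Eu , Ev , u≢v , uv , Ew , vw , spec) =
    swap u , swap v , swap w , Eu , Ev , u≢v ∘ cong swap ,
    adjacent-swap uv , Ew , adjacent-swap vw , spec-swap
    where
    transpose : {x : V (G □ H)} →
                swap x ≡ w ⊎ (E (swap x) ≡ true × swap x ≢ u × swap x ≢ v) →
                x ≡ swap w ⊎ (E (swap x) ≡ true × x ≢ swap u × x ≢ swap v)
    transpose = Sum.map (cong swap) (Product.map₂ (Product.map (_∘ cong swap) (_∘ cong swap)))
    untranspose : {x : V (G □ H)} →
                  x ≡ swap w ⊎ (E (swap x) ≡ true × x ≢ swap u × x ≢ swap v) →
                  swap x ≡ w ⊎ (E (swap x) ≡ true × swap x ≢ u × swap x ≢ v)
    untranspose = Sum.map (cong swap) (Product.map₂ (Product.map (_∘ cong swap) (_∘ cong swap)))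
    spec-swap : ∀ x → (E′ (swap x) ≡ true) ⇔
                      (x ≡ swap w ⊎ (E (swap x) ≡ true × x ≢ swap u × x ≢ swap v))
    spec-swap x = mk⇔ (transpose ∘ Equivalence.to (spec (swap x)))
                      (Equivalence.from (spec (swap x)) ∘ untranspose)

  reachable-swap : {E : Distribution (H □ G)} {t : V (H □ G)} →
                   Reachable (H □ G) E t → Reachable (G □ H) (E ∘ swap) (swap t)
  reachable-swap (E′ , moves , E′t) = E′ ∘ swap , gmap (_∘ swap) move-swap moves , E′t

module Grid {m n : ℕ} where

  private
    G : Graph
    G = K m □ K n

  _≟ᵥ_ : DecidableEquality (Fin m × Fin n)
  _≟ᵥ_ = ≡-dec Finₚ._≟_ Finₚ._≟_

  open Jumps {G} _≟ᵥ_

  row-adjacent : {i : Fin m} {j j′ : Fin n} → j ≢ j′ → Adj G (i , j) (i , j′)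
  row-adjacent j≢j′ = inj₁ (refl , j≢j′)

  column-adjacent : {i i′ : Fin m} {j : Fin n} → i ≢ i′ → Adj G (i , j) (i′ , j)
  column-adjacent i≢i′ = inj₂ (refl , i≢i′)

  record Filled (D : Distribution G) (r : Fin m) (j₁ j₂ c : Fin n) : Set where
    field
      D′          : Distribution G
      moves       : Star (Move G) D D′
      filled      : D′ (r , c) ≡ true
      keeps-pegs  : ∀ x → x ≢ (r , j₁) → x ≢ (r , j₂) → D x ≡ true → D′ x ≡ true
      keeps-holes : ∀ x → x ≢ (r , c) → D x ≡ false → D′ x ≡ false

  fill : ∀ D r {j₁ j₂} c → j₁ ≢ j₂ → D (r , j₁) ≡ true → D (r , j₂) ≡ true →
         Filled D r j₁ j₂ c
  fill D r {j₁} {j₂} c j₁≢j₂ Dj₁ Dj₂ with D (r , c) in Dc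
  ... | true = record
    { D′ = D ; moves = ε ; filled = Dc
    ; keeps-pegs = λ _ _ _ Dx → Dx ; keeps-holes = λ _ _ Dx → Dx }
  ... | false = record
    { D′          = jump D u v w
    ; moves       = jump-move Dj₁ Dj₂ (j₁≢j₂ ∘ ,-injectiveʳ) (row-adjacent j₁≢j₂) Dc
                        (row-adjacent (peg≢hole {D = D} Dj₂ Dc ∘ cong (r ,_))) ◅ ε
    ; filled      = Equivalence.from (jump-spec D u v w w) (inj₁ refl)
    ; keeps-pegs  = λ x x≢u x≢v Dx →
                      Equivalence.from (jump-spec D u v w x) (inj₂ (Dx , x≢u , x≢v))
    ; keeps-holes = λ x x≢w Dx → jump-keeps-holes D u v w x x≢w Dx }
    where
    u v w : Fin m × Fin n
    u = r , j₁
    v = r , j₂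
    w = r , c

  reach-jumping-filled : ∀ D {i j₁ j₂ q₁ c t} → j₁ ≢ j₂ →
    D (i , j₁) ≡ true → D (i , j₂) ≡ true → i ≢ q₁ → i ≢ proj₁ t →
    D (q₁ , c) ≡ true → Adj G (q₁ , c) t → D t ≡ false → Reachable G D t
  reach-jumping-filled D {i} {c = c} {t} j₁≢j₂ Dj₁ Dj₂ i≢q₁ i≢t₁ Dq qt Dt =
    reachable-after {G = G} moves
      (reachable-by-jump filled (keeps-pegs _ (other-row i≢q₁) (other-row i≢q₁) Dq)
                         (i≢q₁ ∘ ,-injectiveˡ) (column-adjacent i≢q₁)
                         (keeps-holes t (other-row i≢t₁) Dt) qt)
    where
    open Filled (fill D i c j₁≢j₂ Dj₁ Dj₂)
    other-row : ∀ {x : Fin m × Fin n} {j} → i ≢ proj₁ x → x ≢ (i , j)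
    other-row i≢x₁ x≡ij = i≢x₁ (sym (cong proj₁ x≡ij))

  reach-jumping-over-filled : ∀ D {r j₁ j₂ k a b} → r ≢ a → j₁ ≢ j₂ →
    k ≢ j₁ → k ≢ j₂ → k ≢ b → D (r , j₁) ≡ true → D (r , j₂) ≡ true →
    D (r , k) ≡ true → D (a , b) ≡ false → Reachable G D (a , b)
  reach-jumping-over-filled D {r} {b = b} r≢a j₁≢j₂ k≢j₁ k≢j₂ k≢b Dj₁ Dj₂ Dk Dt =
    reachable-after {G = G} moves
      (reachable-by-jump (keeps-pegs _ (k≢j₁ ∘ ,-injectiveʳ) (k≢j₂ ∘ ,-injectiveʳ) Dk)
                         filled (k≢b ∘ ,-injectiveʳ) (row-adjacent k≢b)
                         (keeps-holes _ (r≢a ∘ sym ∘ ,-injectiveˡ) Dt)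
                         (column-adjacent r≢a))
    where open Filled (fill D r b j₁≢j₂ Dj₁ Dj₂)

  reach-via-triple : ∀ D {r k₁ k₂ k₃ a b} → r ≢ a →
    k₁ ≢ k₂ → k₁ ≢ k₃ → k₂ ≢ k₃ →
    D (r , k₁) ≡ true → D (r , k₂) ≡ true → D (r , k₃) ≡ true →
    D (a , b) ≡ false → Reachable G D (a , b)
  reach-via-triple D {k₃ = k₃} {b = b} r≢a k₁≢k₂ k₁≢k₃ k₂≢k₃ D₁ D₂ D₃ Dt
    with k₃ Finₚ.≟ b
  ... | no k₃≢b  = reach-jumping-over-filled D r≢a k₁≢k₂ (k₁≢k₃ ∘ sym) (k₂≢k₃ ∘ sym) k₃≢b
                                             D₁ D₂ D₃ Dt
  ... | yes refl = reach-jumping-over-filled D r≢a k₂≢k₃ k₁≢k₂ k₁≢k₃ k₁≢k₃ D₂ D₃ D₁ Dt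

  reach-via-two-doubles : ∀ D {r₁ r₂ j₁ j₂ l₁ l₂ a b} → r₁ ≢ r₂ → r₁ ≢ a → r₂ ≢ a →
    j₁ ≢ j₂ → D (r₁ , j₁) ≡ true → D (r₁ , j₂) ≡ true →
    l₁ ≢ l₂ → D (r₂ , l₁) ≡ true → D (r₂ , l₂) ≡ true →
    D (a , b) ≡ false → Reachable G D (a , b)
  reach-via-two-doubles D {b = b} r₁≢r₂ r₁≢a r₂≢a j₁≢j₂ Dj₁ Dj₂ l₁≢l₂ Dl₁ Dl₂ Dt =
    reachable-after {G = G} moves
      (reach-jumping-filled D′ j₁≢j₂ (kept Dj₁) (kept Dj₂) r₁≢r₂ r₁≢a
                            filled (column-adjacent r₂≢a)
                            (keeps-holes _ (r₂≢a ∘ sym ∘ ,-injectiveˡ) Dt))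
    where
    open Filled (fill D _ b l₁≢l₂ Dl₁ Dl₂)
    kept : ∀ {j} → D (_ , j) ≡ true → D′ (_ , j) ≡ true
    kept = keeps-pegs _ (r₁≢r₂ ∘ ,-injectiveˡ) (r₁≢r₂ ∘ ,-injectiveˡ)

  reach-from-crowded-rows : ∀ D {a b} → pegsInRow D a ≡ 0 → D (a , b) ≡ false →
                            Crowded (pegsInRow D) → Reachable G D (a , b)
  reach-from-crowded-rows D empty Dt (triple r 3≤) with ∃₃-true _ 3≤
  ... | _ , _ , _ , k₁≢k₂ , k₁≢k₃ , k₂≢k₃ , D₁ , D₂ , D₃ =
    reach-via-triple D (positive≢zero (≤-trans (s≤s z≤n) 3≤) empty)
                     k₁≢k₂ k₁≢k₃ k₂≢k₃ D₁ D₂ D₃ Dt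
  reach-from-crowded-rows D empty Dt (doubles r₁ r₂ r₁≢r₂ 2≤₁ 2≤₂)
    with ∃₂-true _ 2≤₁ | ∃₂-true _ 2≤₂
  ... | _ , _ , j₁≢j₂ , Dj₁ , Dj₂ | _ , _ , l₁≢l₂ , Dl₁ , Dl₂ =
    reach-via-two-doubles D r₁≢r₂ (positive≢zero (≤-trans (s≤s z≤n) 2≤₁) empty)
                          (positive≢zero (≤-trans (s≤s z≤n) 2≤₂) empty)
                          j₁≢j₂ Dj₁ Dj₂ l₁≢l₂ Dl₁ Dl₂ Dt

  reach-from-row-peg : ∀ D {a b y} → D (a , y) ≡ true → D (a , b) ≡ false →
                       ∃[ i ] 2 ≤ pegsInRow D i → Reachable G D (a , b)
  reach-from-row-peg D {a} Dy Dt (i , 2≤) with ∃₂-true _ 2≤ | i Finₚ.≟ a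
  ... | _ , _ , j₁≢j₂ , Dj₁ , Dj₂ | yes refl =
    reachable-by-jump Dj₁ Dj₂ (j₁≢j₂ ∘ ,-injectiveʳ) (row-adjacent j₁≢j₂)
                      Dt (row-adjacent (peg≢hole {D = D} Dj₂ Dt ∘ cong (a ,_)))
  ... | _ , _ , j₁≢j₂ , Dj₁ , Dj₂ | no i≢a =
    reach-jumping-filled D j₁≢j₂ Dj₁ Dj₂ i≢a i≢a Dy
                         (row-adjacent (peg≢hole {D = D} Dy Dt ∘ cong (a ,_))) Dt

  reachable-if-rows-overfull : ∀ D → suc m ≤ ∑[ i < m ] pegsInRow D i →
                               ∀ t → Reachable G D t
  reachable-if-rows-overfull D overfull (a , b) with D (a , b) in Dt
  ... | true  = D , ε , Dt
  ... | false with pegsInRow D a in row-a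
  ...   | zero  = reach-from-crowded-rows D row-a Dt (pigeonhole₂-with-empty _ a row-a overfull)
  ...   | suc _ = reach-from-row-peg D (proj₂ (∃-true (λ j → D (a , j)) 1≤row-a))
                                     Dt (pigeonhole _ overfull)
    where
    1≤row-a : 1 ≤ pegsInRow D a
    1≤row-a = subst (1 ≤_) (sym row-a) (s≤s z≤n)

  allReachable-suc-rows : AllReachable G (suc m)
  allReachable-suc-rows D size≡ =
    reachable-if-rows-overfull D (≤-reflexive (trans (sym size≡) (size-□ D)))

size-swap : {m n : ℕ} (D : Distribution (K m □ K n)) →
            size (K n □ K m) (D ∘ swap) ≡ size (K m □ K n) D
size-swap D = trans (size-□ (D ∘ swap))
                    (trans (sym (∑-comm λ i j → indicator (D (i , j)))) (sym (size-□ D)))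

allReachable-swap : {m n d : ℕ} → AllReachable (K n □ K m) d → AllReachable (K m □ K n) d
allReachable-swap {m} {n} all D size≡ t =
  reachable-swap {K m} {K n} (all (D ∘ swap) (trans (size-swap D) size≡) (swap t))

allReachable-⊓ : {m n : ℕ} → AllReachable (K m □ K n) (m ⊓ n + 1)
allReachable-⊓ {m} {n} =
  subst (AllReachable (K m □ K n)) (+-comm 1 (m ⊓ n)) (by-selection (⊓-sel m n))
  where
  by-selection : m ⊓ n ≡ m ⊎ m ⊓ n ≡ n → AllReachable (K m □ K n) (suc (m ⊓ n))
  by-selection (inj₁ m⊓n≡m) =
    subst (AllReachable (K m □ K n) ∘ suc) (sym m⊓n≡m) Grid.allReachable-suc-rows
  by-selection (inj₂ m⊓n≡n) =
    subst (AllReachable (K m □ K n) ∘ suc) (sym m⊓n≡n) (allReachable-swap Grid.allReachable-suc-rows)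

independent-≤-rows : {m n : ℕ} {S : Distribution (K m □ K n)} →
                     Independent (K m □ K n) S → size (K m □ K n) S ≤ m
independent-≤-rows {S = S} S-ind =
  subst (_≤ _) (sym (size-□ S)) (∑-≤-card _ at-most-one)
  where
  at-most-one : ∀ i → pegsInRow S i ≤ 1
  at-most-one i with 2 ≤? pegsInRow S i
  ... | no 2≰ = ≤-pred (≰⇒> 2≰)
  ... | yes 2≤ with ∃₂-true _ 2≤
  ...   | _ , _ , j≢j′ , Sj , Sj′ = contradiction (inj₁ (refl , j≢j′)) (S-ind _ _ Sj Sj′)

independent-≤-⊓ : {m n : ℕ} {S : Distribution (K m □ K n)} →
                  Independent (K m □ K n) S → size (K m □ K n) S ≤ m ⊓ n
independent-≤-⊓ {m} {n} {S} S-ind =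
  ⊓-glb (independent-≤-rows S-ind)
        (subst (_≤ n) (size-swap S)
               (independent-≤-rows (independent-swap {K m} {K n} S-ind)))

diagonal : {m n : ℕ} → ℕ → Distribution (K m □ K n)
diagonal e (i , j) = (toℕ i <ᵇ e) ∧ (toℕ i ≡ᵇ toℕ j)

on-diagonal : {m n : ℕ} (e : ℕ) (i : Fin m) (j : Fin n) →
              diagonal e (i , j) ≡ true → toℕ i ≡ toℕ j
on-diagonal e i j h = ≡ᵇ⇒≡ _ _ (proj₂ (Equivalence.to T-∧ (Equivalence.from T-≡ h)))

diagonal-independent : {m n : ℕ} (e : ℕ) → Independent (K m □ K n) (diagonal e)
diagonal-independent e (i , j) (i , j′) Dx Dy (inj₁ (refl , j≢j′)) =
  j≢j′ (Finₚ.toℕ-injective (trans (sym (on-diagonal e i j Dx)) (on-diagonal e i j′ Dy)))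
diagonal-independent e (i , j) (i′ , j) Dx Dy (inj₂ (refl , i≢i′)) =
  i≢i′ (Finₚ.toℕ-injective (trans (on-diagonal e i j Dx) (sym (on-diagonal e i′ j Dy))))

∑-indicator-≡ᵇ : {n : ℕ} (c : ℕ) → c < n → ∑[ j < n ] indicator (c ≡ᵇ toℕ j) ≡ 1
∑-indicator-≡ᵇ {suc n} zero    _          = cong suc (sum-replicate-zero n)
∑-indicator-≡ᵇ {suc n} (suc c) (s≤s c<n) = ∑-indicator-≡ᵇ c c<n

∑-indicator-<ᵇ : {m : ℕ} (e : ℕ) → e ≤ m → ∑[ i < m ] indicator (toℕ i <ᵇ e) ≡ e
∑-indicator-<ᵇ {m}     zero    _         = sum-replicate-zero m
∑-indicator-<ᵇ {suc m} (suc e) (s≤s e≤m) = cong suc (∑-indicator-<ᵇ e e≤m)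

diagonal-row : {m n e : ℕ} → e ≤ n → (i : Fin m) →
               pegsInRow (diagonal {m} {n} e) i ≡ indicator (toℕ i <ᵇ e)
diagonal-row {n = n} {e} e≤n i =
  on-row (toℕ i <ᵇ e) (λ lt → <-≤-trans (<ᵇ⇒< _ _ lt) e≤n)
  where
  on-row : ∀ β → (T β → toℕ i < n) →
           ∑[ j < n ] indicator (β ∧ (toℕ i ≡ᵇ toℕ j)) ≡ indicator β
  on-row false _   = sum-replicate-zero n
  on-row true  i<n = ∑-indicator-≡ᵇ (toℕ i) (i<n tt)

size-diagonal : {m n e : ℕ} → e ≤ m → e ≤ n → size (K m □ K n) (diagonal e) ≡ e
size-diagonal {m} {n} {e} e≤m e≤n =
  trans (size-□ (diagonal {m} {n} e))
        (trans (sum-cong-≗ {x = pegsInRow (diagonal {m} {n} e)} (diagonal-row e≤n))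
               (∑-indicator-<ᵇ e e≤m))

off-diagonal-vertex : {m n : ℕ} → 1 ≤ m → 1 ≤ n → ¬ (m ≡ 1 × n ≡ 1) →
                      ∃[ t ] ∀ e → diagonal {m} {n} e t ≡ false
off-diagonal-vertex {suc _}       {suc (suc _)} _ _ _ =
  (Fin.zero , Fin.suc Fin.zero) , λ _ → ∧-zeroʳ _
off-diagonal-vertex {suc (suc _)} {suc zero}    _ _ _ =
  (Fin.suc Fin.zero , Fin.zero) , λ _ → ∧-zeroʳ _
off-diagonal-vertex {suc zero}    {suc zero}    _ _ not-both-1 =
  contradiction (refl , refl) not-both-1

isIndependenceNumber-⊓ : {m n : ℕ} → IsIndependenceNumber (K m □ K n) (m ⊓ n)
isIndependenceNumber-⊓ {m} {n} =
  (diagonal (m ⊓ n) , diagonal-independent (m ⊓ n) , size-diagonal (m⊓n≤m m n) (m⊓n≤n m n)) ,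
  λ _ → independent-≤-⊓

¬AllReachable-≤-⊓ : {m n d : ℕ} → ∃[ t ] (∀ e → diagonal {m} {n} e t ≡ false) →
                    d ≤ m ⊓ n → ¬ AllReachable (K m □ K n) d
¬AllReachable-≤-⊓ {m} {n} {d} (t , off) d≤m⊓n =
  subst (¬_ ∘ AllReachable (K m □ K n))
        (size-diagonal (≤-trans d≤m⊓n (m⊓n≤m m n)) (≤-trans d≤m⊓n (m⊓n≤n m n)))
        (independent⇒¬AllReachable (K m □ K n) (diagonal-independent d) (off d))

proposition4p1 : (m n : ℕ) → 1 ≤ m → 1 ≤ n → ¬ (m ≡ 1 × n ≡ 1) →
    ∃[ a ] ( IsIndependenceNumber (K m □ K n) a
           × IsPeggingNumber (K m □ K n) (a + 1)
           × a ≡ m ⊓ n )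
proposition4p1 m n 1≤m 1≤n not-both-1 =
  m ⊓ n , isIndependenceNumber-⊓ , (m≤n+m 1 (m ⊓ n) , allReachable-⊓ , below) , refl
  where
  below : ∀ d → 1 ≤ d → d < m ⊓ n + 1 → ¬ AllReachable (K m □ K n) d
  below d _ d<m⊓n+1 =
    ¬AllReachable-≤-⊓ (off-diagonal-vertex 1≤m 1≤n not-both-1)
                      (m<1+n⇒m≤n (subst (d <_) (+-comm (m ⊓ n) 1) d<m⊓n+1))
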